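{- Let $a\ge0$, $b>0$ and $\alpha\in\{0,1\}^a$, let $\beta=0^a1^b\alpha$ and $n=|\beta|$, and let $\mathbb{A}$ be the algebra $\mathrm{id\mbox{ - }Pol}(\mathcal{P}_\beta)$. For each $m\ge1$, $\mathbb{A}^m$ is generated by the $m+1$ tuples $(1,1,\dots,1)$, $(n,1,\dots,1)$, $(1,n,1,\dots,1)$, $\dots$, $(1,\dots,1,n)$.
   Context: For $\beta\in\{0,1\}^n$, $\mathcal{P}_\beta$ is the undirected graph on vertices $1,\dots,n$ with edges $\{i,i+1\}$ for $i<n$ and a loop at $i$ iff the $i$-th letter of $\beta$ is $1$. $\mathrm{id\mbox{ - }Pol}(\mathcal{P}_\beta)$ is the set of idempotent polymorphisms (maps $f:[n]^k\to[n]$ preserving the edge relation coordinatewise with $f(x,\dots,x)=x$), viewed as an algebra on $[n]$. A set $S\subseteq[n]^m$ generates $\mathbb{A}^m$ if every tuple in $[n]^m$ is the closure of $S$ under coordinatewise application of operations of $\mathrm{id\mbox{ - }Pol}(\mathcal{P}_\beta)$, i.e. every tuple equals $f(s_1,\dots,s_k)$ coordinatewise for some $f\in\mathrm{id\mbox{ - }Pol}(\mathcal{P}_\beta)$ and $s_1,\dots,s_k\in S$. -}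

module Defs where

open import Data.Nat using (ℕ; suc; _∸_)
open import Data.Bool using (Bool; true; false)
open import Data.Fin using (Fin; toℕ)
open import Data.List using (List; replicate; _++_; length; lookup)
open import Data.Vec using (Vec; toList)
open import Data.Product using (Σ; ∃; ∃-syntax; _×_; _,_)
open import Data.Sum using (_⊎_)
open import Data.Empty using (⊥)
open import Relation.Binary.PropositionalEquality using (_≡_)

βword : (a b : ℕ) → Vec Bool a → List Bool
βword a b α = replicate a false ++ (replicate b true ++ toList α)

-- Vertices of P_β: Fin (length β); vertex i ∈ Fin n stands for the paper's i+1.
Vertex : List Bool → Set
Vertex β = Fin (length β)

Adj : (β : List Bool) → Vertex β → Vertex β → Set
Adj β u v = (toℕ u ≡ suc (toℕ v)) ⊎ ((toℕ v ≡ suc (toℕ u)) ⊎ ((u ≡ v) × (lookup β u ≡ true)))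

IsIdPol : (β : List Bool) (k : ℕ) → ((Fin k → Vertex β) → Vertex β) → Set
IsIdPol β k f =
  ((x y : Fin k → Vertex β) → (∀ i → Adj β (x i) (y i)) → Adj β (f x) (f y))
  × (∀ (v : Vertex β) → f (λ _ → v) ≡ v)

-- The generating set S: (1,…,1) and, for each position i, the tuple with n at i and 1 elsewhere.
-- (In 0-based vertex labels: 1 ↦ toℕ 0, n ↦ toℕ (n-1).)
IsGenerator : (β : List Bool) (m : ℕ) → (Fin m → Vertex β) → Set
IsGenerator β m t =
  (∀ j → toℕ (t j) ≡ 0)
  ⊎ (∃[ i ] ((toℕ (t i) ≡ length β ∸ 1) × (∀ j → (j ≡ i → ⊥) → toℕ (t j) ≡ 0)))

Generates : (β : List Bool) (m : ℕ) → ((Fin m → Vertex β) → Set) → Set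
Generates β m S =
  (t : Fin m → Vertex β) →
  ∃[ k ] Σ ((Fin k → (Fin m → Vertex β)) × ((Fin k → Vertex β) → Vertex β)) λ where
    (s , f) → (∀ i → S (s i)) × IsIdPol β k f × (∀ j → t j ≡ f (λ i → s i j))

module Submission where

open import Defs
open import Data.Nat using (ℕ; zero; suc; pred; _+_; _∸_; _⊓_; _⊔_; _≤_; _<_; z≤n; s≤s; _≤?_; _<?_; _≟_)
open import Data.Nat.Properties
open import Data.Bool using (Bool; true; false)
open import Data.Fin using (Fin; toℕ; fromℕ<; zero; suc)
open import Data.Fin.Properties using (toℕ-fromℕ<; toℕ-injective; toℕ<n)
open import Data.List using (List; replicate; _++_; length; lookup)
open import Data.List.Properties using (length-++; length-replicate)
open import Data.Vec using (Vec; toList)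
open import Data.Vec.Properties using (length-toList)
open import Data.Vec.Functional using (head; tail)
open import Data.Product using (Σ; _×_; _,_)
open import Data.Sum using (_⊎_; inj₁; inj₂)
open import Data.Empty using (⊥; ⊥-elim)
open import Relation.Nullary using (¬_; yes; no)
open import Relation.Binary.PropositionalEquality
open import Relation.Binary.Definitions using (tri<; tri≈; tri>)

-- Composing binary polymorphisms reduces the theorem to finding, for every vertex t, a binary
-- idempotent polymorphism ψ with ψ(x, 1) = x and ψ(1, n) = t.  Number the vertices 0, …, c + a
-- with c = a + b − 1: then [0, a) carries no loops, [a, c] carries loops and (c, c + a] is
-- arbitrary.  Take ψ(x, y) = max(x, fold(x, γ y)), where γ is a 1-Lipschitz walk with γ y ≤ y
-- ending at t, and fold(x, g) = g for g in the looped block [a, c].  For g ≤ a, fold(x, g) is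
-- the least value ≥ max(x, g) with the parity of x + ε y, capped at a, so that a step in x
-- (necessarily a step along the path while x < a) moves it by exactly one; for g ≥ c it is the
-- mirror image of that.  The parity offset ε may only change while γ is in the looped block.

record Pivot (β : List Bool) (bot top t : Vertex β) : Set where
  field
    op      : Vertex β → Vertex β → Vertex β
    op-adj  : ∀ {u u' v v'} → Adj β u u' → Adj β v v' → Adj β (op u v) (op u' v')
    op-idem : ∀ u → op u u ≡ u
    op-bot  : ∀ u → op u bot ≡ u
    op-top  : op bot top ≡ t

module Generation {β : List Bool} {bot top : Vertex β} (pivot : ∀ t → Pivot β bot top t) where
  open Pivot

  chain : ∀ m → (Fin m → Vertex β) → Vertex β → (Fin m → Vertex β) → Vertex β
  chain zero    ts x₀ rs = x₀
  chain (suc m) ts x₀ rs = op (pivot (head ts)) (chain m (tail ts) x₀ (tail rs)) (head rs)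

  chain-adj : ∀ m ts {x₀ y₀ rs rs'} → Adj β x₀ y₀ → (∀ i → Adj β (rs i) (rs' i)) →
              Adj β (chain m ts x₀ rs) (chain m ts y₀ rs')
  chain-adj zero    ts x₀~y₀ rs~rs' = x₀~y₀
  chain-adj (suc m) ts x₀~y₀ rs~rs' =
    op-adj (pivot (head ts)) (chain-adj m (tail ts) x₀~y₀ (λ i → rs~rs' (suc i))) (rs~rs' zero)

  chain-idem : ∀ m ts v → chain m ts v (λ _ → v) ≡ v
  chain-idem zero    ts v = refl
  chain-idem (suc m) ts v rewrite chain-idem m (tail ts) v = op-idem (pivot (head ts)) v

  unit : ∀ {m} → Fin m → Fin m → Vertex β
  unit zero    zero    = top
  unit zero    (suc _) = bot
  unit (suc _) zero    = bot
  unit (suc i) (suc j) = unit i j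

  unit-diag : ∀ {m} (i : Fin m) → unit i i ≡ top
  unit-diag zero    = refl
  unit-diag (suc i) = unit-diag i

  unit-off : ∀ {m} (i j : Fin m) → (j ≡ i → ⊥) → unit i j ≡ bot
  unit-off zero    zero    j≢i = ⊥-elim (j≢i refl)
  unit-off zero    (suc j) j≢i = refl
  unit-off (suc i) zero    j≢i = refl
  unit-off (suc i) (suc j) j≢i = unit-off i j (λ j≡i → j≢i (cong suc j≡i))

  chain-unit : ∀ m ts j → chain m ts bot (λ i → unit i j) ≡ ts j
  chain-unit (suc m) ts zero    rewrite chain-idem m (tail ts) bot = op-top (pivot (head ts))
  chain-unit (suc m) ts (suc j) rewrite chain-unit m (tail ts) j   = op-bot (pivot (head ts)) (ts (suc j))

  generator : ∀ m → Fin (suc m) → Fin m → Vertex β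
  generator m zero    = λ _ → bot
  generator m (suc i) = unit i

  generator-valid : toℕ bot ≡ 0 → toℕ top ≡ length β ∸ 1 → ∀ m i → IsGenerator β m (generator m i)
  generator-valid bot≡0 top≡n m zero    = inj₁ (λ _ → bot≡0)
  generator-valid bot≡0 top≡n m (suc i) =
    inj₂ (i , trans (cong toℕ (unit-diag i)) top≡n , λ j j≢i → trans (cong toℕ (unit-off i j j≢i)) bot≡0)

  generates : toℕ bot ≡ 0 → toℕ top ≡ length β ∸ 1 → ∀ m → Generates β m (IsGenerator β m)
  generates bot≡0 top≡n m t =
    suc m , (generator m , f) , generator-valid bot≡0 top≡n m , (f-adj , f-idem) , λ j → sym (chain-unit m t j)
    where
    f : (Fin (suc m) → Vertex β) → Vertex β
    f xs = chain m t (head xs) (tail xs)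
    f-adj : ∀ xs ys → (∀ i → Adj β (xs i) (ys i)) → Adj β (f xs) (f ys)
    f-adj xs ys xs~ys = chain-adj m t (xs~ys zero) (λ i → xs~ys (suc i))
    f-idem : ∀ v → f (λ _ → v) ≡ v
    f-idem = chain-idem m t

Close : ℕ → ℕ → Set
Close u v = (u ≡ v) ⊎ ((v ≡ suc u) ⊎ (u ≡ suc v))

close-sym : ∀ {u v} → Close u v → Close v u
close-sym (inj₁ u≡v)        = inj₁ (sym u≡v)
close-sym (inj₂ (inj₁ v≡u)) = inj₂ (inj₂ v≡u)
close-sym (inj₂ (inj₂ u≡v)) = inj₂ (inj₁ u≡v)

close-suc : ∀ u → Close u (suc u)
close-suc u = inj₂ (inj₁ refl)

close⇒≤ : ∀ {u v} → Close u v → u ≤ suc v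
close⇒≤ (inj₁ refl)        = n≤1+n _
close⇒≤ (inj₂ (inj₁ refl)) = ≤-trans (n≤1+n _) (n≤1+n _)
close⇒≤ (inj₂ (inj₂ refl)) = ≤-refl

≤⇒close : ∀ {u v} → u ≤ suc v → v ≤ suc u → Close u v
≤⇒close {u} {v} u≤1+v v≤1+u with <-cmp u v
... | tri≈ _ u≡v _ = inj₁ u≡v
... | tri< u<v _ _ = inj₂ (inj₁ (≤-antisym v≤1+u u<v))
... | tri> _ _ v<u = inj₂ (inj₂ (≤-antisym u≤1+v v<u))

close-⊔ : ∀ {u u' v v'} → Close u u' → Close v v' → Close (u ⊔ v) (u' ⊔ v')
close-⊔ cu cv = ≤⇒close (⊔-mono-≤ (close⇒≤ cu) (close⇒≤ cv))
                        (⊔-mono-≤ (close⇒≤ (close-sym cu)) (close⇒≤ (close-sym cv)))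

close-⊓ : ∀ {u u' v v'} → Close u u' → Close v v' → Close (u ⊓ v) (u' ⊓ v')
close-⊓ cu cv = ≤⇒close (⊓-mono-≤ (close⇒≤ cu) (close⇒≤ cv))
                        (⊓-mono-≤ (close⇒≤ (close-sym cu)) (close⇒≤ (close-sym cv)))

Lipschitz : (ℕ → ℕ) → Set
Lipschitz f = ∀ y → Close (f y) (f (suc y))

lipschitz-close : ∀ {f} → Lipschitz f → ∀ {y y'} → Close y y' → Close (f y) (f y')
lipschitz-close f-lip (inj₁ refl)        = inj₁ refl
lipschitz-close f-lip (inj₂ (inj₁ refl)) = f-lip _
lipschitz-close f-lip (inj₂ (inj₂ refl)) = close-sym (f-lip _)

+-lipschitz : ∀ k → Lipschitz (k +_)
+-lipschitz k y = inj₂ (inj₁ (+-suc k y))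

∸ʳ-lipschitz : ∀ d → Lipschitz (_∸ d)
∸ʳ-lipschitz zero    y       = close-suc y
∸ʳ-lipschitz (suc d) zero    = inj₁ (sym (0∸n≡0 d))
∸ʳ-lipschitz (suc d) (suc y) = ∸ʳ-lipschitz d y

∸ˡ-lipschitz : ∀ d → Lipschitz (d ∸_)
∸ˡ-lipschitz zero    zero    = inj₁ refl
∸ˡ-lipschitz zero    (suc y) = inj₁ refl
∸ˡ-lipschitz (suc d) zero    = inj₂ (inj₂ refl)
∸ˡ-lipschitz (suc d) (suc y) = ∸ˡ-lipschitz d y

mod2 : ℕ → ℕ
mod2 zero          = 0
mod2 (suc zero)    = 1
mod2 (suc (suc n)) = mod2 n

mod2≡0⊎mod2≡1 : ∀ n → mod2 n ≡ 0 ⊎ mod2 n ≡ 1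
mod2≡0⊎mod2≡1 zero          = inj₁ refl
mod2≡0⊎mod2≡1 (suc zero)    = inj₂ refl
mod2≡0⊎mod2≡1 (suc (suc n)) = mod2≡0⊎mod2≡1 n

mod2-suc : ∀ n → (mod2 n ≡ 0 × mod2 (suc n) ≡ 1) ⊎ (mod2 n ≡ 1 × mod2 (suc n) ≡ 0)
mod2-suc zero          = inj₁ (refl , refl)
mod2-suc (suc zero)    = inj₂ (refl , refl)
mod2-suc (suc (suc n)) = mod2-suc n

mod2-double : ∀ n → mod2 (n + n) ≡ 0
mod2-double zero    = refl
mod2-double (suc n) rewrite +-suc n n = mod2-double n

mod2-+-double : ∀ m n → mod2 (m + (n + n)) ≡ mod2 m
mod2-+-double m zero    rewrite +-identityʳ m = refl
mod2-+-double m (suc n) rewrite +-suc n n | +-suc m (suc (n + n)) | +-suc m (n + n) = mod2-+-double m n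

mod2-+-mod2 : ∀ n → mod2 (n + mod2 n) ≡ 0
mod2-+-mod2 zero          = refl
mod2-+-mod2 (suc zero)    = refl
mod2-+-mod2 (suc (suc n)) = mod2-+-mod2 n

∸+mod2≤ : ∀ m n → n < m → (m ∸ n) + mod2 n ≤ m
∸+mod2≤ m zero n<m rewrite +-identityʳ m = ≤-refl
∸+mod2≤ m (suc n) n<m with mod2≡0⊎mod2≡1 (suc n)
... | inj₁ e rewrite e | +-identityʳ (m ∸ suc n) = m∸n≤m m (suc n)
∸+mod2≤ (suc m) (suc n) n<m | inj₂ e rewrite e | +-comm (m ∸ n) 1 = s≤s (m∸n≤m m n)

roundUp : ℕ → ℕ → ℕ
roundUp p M = M + mod2 (M + p)

roundUp-step : ∀ p {M M'} → Close M M' →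
  (roundUp (suc p) M' ≡ suc (roundUp p M)) ⊎ (roundUp p M ≡ suc (roundUp (suc p) M'))
roundUp-step p {M} (inj₁ refl) rewrite +-suc M p with mod2-suc (M + p)
... | inj₁ (e₀ , e₁) rewrite e₀ | e₁ = inj₁ (+-suc M 0)
... | inj₂ (e₁ , e₀) rewrite e₀ | e₁ = inj₂ (+-suc M 0)
roundUp-step p {M} (inj₂ (inj₁ refl)) rewrite +-suc M p = inj₁ refl
roundUp-step p {_} {M'} (inj₂ (inj₂ refl)) rewrite +-suc M' p = inj₂ refl

stepAbove : ℕ → ℕ → ℕ → ℕ
stepAbove zero    δ zero    = 0
stepAbove zero    δ (suc y) = δ
stepAbove (suc B) δ zero    = 0
stepAbove (suc B) δ (suc y) = stepAbove B δ y

stepAbove-low : ∀ B δ y → y ≤ B → stepAbove B δ y ≡ 0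
stepAbove-low zero    δ zero    _         = refl
stepAbove-low (suc B) δ zero    _         = refl
stepAbove-low (suc B) δ (suc y) (s≤s y≤B) = stepAbove-low B δ y y≤B

stepAbove-high : ∀ B δ y → B < y → stepAbove B δ y ≡ δ
stepAbove-high zero    δ (suc y) _         = refl
stepAbove-high (suc B) δ (suc y) (s≤s B<y) = stepAbove-high B δ y B<y

module Folding (a c : ℕ) (a≤c : a ≤ c) where

  lower : ℕ → ℕ → ℕ → ℕ
  lower e x g = a ⊓ roundUp (x + e) (x ⊔ g)

  fold : ℕ → ℕ → ℕ → ℕ
  fold e x g = lower e x g + ((g ⊓ c) ∸ a) + (a ∸ lower e x ((c + a) ∸ g))

  CappedStep : ℕ → ℕ → Set
  CappedStep L L' = (L' ≡ suc L) ⊎ ((L ≡ suc L') ⊎ ((L ≡ a) × (L' ≡ a)))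

  CappedStep-sym : ∀ {L L'} → CappedStep L' L → CappedStep L L'
  CappedStep-sym (inj₁ e)                 = inj₂ (inj₁ e)
  CappedStep-sym (inj₂ (inj₁ e))          = inj₁ e
  CappedStep-sym (inj₂ (inj₂ (e₁ , e₂))) = inj₂ (inj₂ (e₂ , e₁))

  CappedStep-⊓ : ∀ {u u'} → u' ≡ suc u → CappedStep (a ⊓ u) (a ⊓ u')
  CappedStep-⊓ {u} refl with suc u ≤? a
  ... | yes 1+u≤a = inj₁ (trans (m≥n⇒m⊓n≡n 1+u≤a) (cong suc (sym (m≥n⇒m⊓n≡n (≤-trans (n≤1+n u) 1+u≤a)))))
  ... | no  1+u≰a = let u≥a = ≤-pred (≰⇒> 1+u≰a) in
                    inj₂ (inj₂ (m≤n⇒m⊓n≡m u≥a , m≤n⇒m⊓n≡m (≤-trans u≥a (n≤1+n u))))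

  lower-step : ∀ e x {g g'} → Close g g' → CappedStep (lower e x g) (lower e (suc x) g')
  lower-step e x g~g' with roundUp-step (x + e) (close-⊔ (close-suc x) g~g')
  ... | inj₁ up   = CappedStep-⊓ up
  ... | inj₂ down = CappedStep-sym (CappedStep-⊓ down)

  lower≤a : ∀ e x g → lower e x g ≤ a
  lower≤a e x g = m⊓n≤m a _

  lower-saturated : ∀ e x g → a ≤ x ⊔ g → lower e x g ≡ a
  lower-saturated e x g a≤x⊔g = m≤n⇒m⊓n≡m (≤-trans a≤x⊔g (m≤m+n _ _))

  lower-diag : ∀ x g → g ≤ x → lower 0 x g ≤ x
  lower-diag x g g≤x rewrite m≥n⇒m⊔n≡m g≤x | +-identityʳ x | mod2-double x | +-identityʳ x = m⊓n≤n a x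

  lower-exact : ∀ e t → t ≤ a → mod2 (t + e) ≡ 0 → lower e 0 t ≡ t
  lower-exact e t t≤a t+e-even = begin
    a ⊓ (t + mod2 (t + e)) ≡⟨ cong (λ r → a ⊓ (t + r)) t+e-even ⟩
    a ⊓ (t + 0)            ≡⟨ cong (a ⊓_) (+-identityʳ t) ⟩
    a ⊓ t                  ≡⟨ m≥n⇒m⊓n≡n t≤a ⟩
    t                      ∎
    where open ≡-Reasoning

  a≤mirror : ∀ g → g ≤ c → a ≤ (c + a) ∸ g
  a≤mirror g g≤c rewrite +-∸-comm a g≤c = m≤n+m a (c ∸ g)

  fold-low : ∀ e x g → g ≤ a → fold e x g ≡ lower e x g
  fold-low e x g g≤a
    rewrite m≤n⇒m∸n≡0 {g ⊓ c} {a} (≤-trans (m⊓n≤m g c) g≤a)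
          | lower-saturated e x ((c + a) ∸ g) (≤-trans (a≤mirror g (≤-trans g≤a a≤c)) (m≤n⊔m x _))
          | n∸n≡0 a = trans (+-identityʳ _) (+-identityʳ _)

  fold-mid : ∀ e x g → a ≤ g → g ≤ c → fold e x g ≡ g
  fold-mid e x g a≤g g≤c
    rewrite lower-saturated e x g (≤-trans a≤g (m≤n⊔m x g))
          | m≤n⇒m⊓n≡m g≤c
          | lower-saturated e x ((c + a) ∸ g) (≤-trans (a≤mirror g g≤c) (m≤n⊔m x _))
          | n∸n≡0 a = trans (+-identityʳ _) (m+[n∸m]≡n a≤g)

  fold-high : ∀ e x g → c ≤ g → fold e x g ≡ c + (a ∸ lower e x ((c + a) ∸ g))
  fold-high e x g c≤g
    rewrite lower-saturated e x g (≤-trans (≤-trans a≤c c≤g) (m≤n⊔m x g))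
          | m≥n⇒m⊓n≡n c≤g
          | m+[n∸m]≡n a≤c = refl

  a+[m∸a]≡a⊔m : ∀ m → a + (m ∸ a) ≡ a ⊔ m
  a+[m∸a]≡a⊔m m with a ≤? m
  ... | yes a≤m = trans (m+[n∸m]≡n a≤m) (sym (m≤n⇒m⊔n≡n a≤m))
  ... | no  a≰m = let m≤a = ≤-trans (n≤1+n m) (≰⇒> a≰m) in
                  trans (cong (a +_) (m≤n⇒m∸n≡0 m≤a)) (trans (+-identityʳ a) (sym (m≥n⇒m⊔n≡m m≤a)))

  fold-right : ∀ e x g → a ≤ x → fold e x g ≡ a ⊔ (g ⊓ c)
  fold-right e x g a≤x
    rewrite lower-saturated e x g (≤-trans a≤x (m≤m⊔n x g))
          | lower-saturated e x ((c + a) ∸ g) (≤-trans a≤x (m≤m⊔n x _))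
          | n∸n≡0 a = trans (+-identityʳ _) (a+[m∸a]≡a⊔m (g ⊓ c))

  fold≤c+a : ∀ e x g → fold e x g ≤ c + a
  fold≤c+a e x g =
    ≤-trans (+-mono-≤ (+-mono-≤ (lower≤a e x g) (∸-monoˡ-≤ a (m⊓n≤n g c))) (m∸n≤m a (lower e x ((c + a) ∸ g))))
            (≤-reflexive (cong (_+ a) (m+[n∸m]≡n a≤c)))

  x≤fold : ∀ e x g → x ≤ a → x ≤ fold e x g
  x≤fold e x g x≤a = ≤-trans (⊓-glb x≤a (≤-trans (m≤m⊔n x g) (m≤m+n _ _))) (≤-trans (m≤m+n _ _) (m≤m+n _ _))

  fold≤ : ∀ e x g → g ≤ x → a ≤ x ⊎ e ≡ 0 → fold e x g ≤ x
  fold≤ e x g g≤x (inj₁ a≤x) rewrite fold-right e x g a≤x = ⊔-lub a≤x (≤-trans (m⊓n≤m g c) g≤x)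
  fold≤ .0 x g g≤x (inj₂ refl) with a ≤? x
  ... | yes a≤x = fold≤ 0 x g g≤x (inj₁ a≤x)
  ... | no  a≰x rewrite fold-low 0 x g (≤-trans g≤x (<⇒≤ (≰⇒> a≰x))) = lower-diag x g g≤x

  InLoops : ℕ → Set
  InLoops v = (a ≤ v) × (v ≤ c)

  Switch : (ℕ → ℕ) → (ℕ → ℕ) → Set
  Switch γ ε = ∀ {y y'} → Close y y' → (ε y ≡ ε y') ⊎ (InLoops (γ y) × InLoops (γ y'))

  stepAbove-switch : ∀ γ B δ → (δ ≡ 0 ⊎ (InLoops (γ B) × InLoops (γ (suc B)))) → Switch γ (stepAbove B δ)
  stepAbove-switch γ B δ at-B = switch
    where
    switch-suc : ∀ y → (stepAbove B δ y ≡ stepAbove B δ (suc y)) ⊎ (InLoops (γ y) × InLoops (γ (suc y)))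
    switch-suc y with <-cmp y B
    ... | tri< y<B _ _ = inj₁ (trans (stepAbove-low B δ y (<⇒≤ y<B)) (sym (stepAbove-low B δ (suc y) y<B)))
    ... | tri> _ _ B<y = inj₁ (trans (stepAbove-high B δ y B<y) (sym (stepAbove-high B δ (suc y) (≤-trans B<y (n≤1+n y)))))
    ... | tri≈ _ refl _ = boundary at-B
      where
      boundary : δ ≡ 0 ⊎ (InLoops (γ B) × InLoops (γ (suc B))) →
                 (stepAbove B δ B ≡ stepAbove B δ (suc B)) ⊎ (InLoops (γ B) × InLoops (γ (suc B)))
      boundary (inj₁ δ≡0)  =
        inj₁ (trans (stepAbove-low B δ B ≤-refl) (sym (trans (stepAbove-high B δ (suc B) ≤-refl) δ≡0)))
      boundary (inj₂ loops) = inj₂ loops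
    switch : Switch γ (stepAbove B δ)
    switch (inj₁ refl) = inj₁ refl
    switch (inj₂ (inj₁ refl)) = switch-suc _
    switch (inj₂ (inj₂ refl)) with switch-suc _
    ... | inj₁ e                = inj₁ (sym e)
    ... | inj₂ (loops , loops') = inj₂ (loops' , loops)

  record Schedule (t : ℕ) : Set where
    field
      γ           : ℕ → ℕ
      ε           : ℕ → ℕ
      γ-lipschitz : Lipschitz γ
      γ≤id        : ∀ y → γ y ≤ y
      ε-switch    : Switch γ ε
      ε-low       : ∀ y → y ≤ a → ε y ≡ 0
      reaches     : fold (ε (c + a)) 0 (γ (c + a)) ≡ t

  schedule-loops : ∀ t → a ≤ t → t ≤ c → Schedule t
  schedule-loops t a≤t t≤c = record
    { γ           = _⊓ t
    ; ε           = λ _ → 0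
    ; γ-lipschitz = λ y → close-⊓ (close-suc y) (inj₁ refl)
    ; γ≤id        = λ y → m⊓n≤m y t
    ; ε-switch    = λ _ → inj₁ refl
    ; ε-low       = λ _ _ → refl
    ; reaches     = trans (cong (fold 0 0) (m≥n⇒m⊓n≡n (≤-trans t≤c (m≤m+n c a)))) (fold-mid 0 0 t a≤t t≤c)
    }

  -- γ climbs to a, waits there mod2 t steps to fix the parity, then descends to t.
  module BelowLoops (t : ℕ) (t<a : t < a) where
    δ = mod2 t
    k = a ∸ t

    γ : ℕ → ℕ
    γ y = (y ⊓ a) ∸ ((y ∸ (a + δ)) ⊓ k)

    γ-lipschitz : Lipschitz γ
    γ-lipschitz y with suc y ≤? a
    ... | yes 1+y≤a rewrite m≤n⇒m⊓n≡m 1+y≤a | m≤n⇒m⊓n≡m (≤-trans (n≤1+n y) 1+y≤a)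
                          | m≤n⇒m∸n≡0 (≤-trans 1+y≤a (m≤m+n a δ))
                          | m≤n⇒m∸n≡0 (≤-trans (≤-trans (n≤1+n y) 1+y≤a) (m≤m+n a δ))
                          = close-suc _
    ... | no  1+y≰a rewrite m≥n⇒m⊓n≡n (≤-pred (≰⇒> 1+y≰a))
                          | m≥n⇒m⊓n≡n (≤-trans (≤-pred (≰⇒> 1+y≰a)) (n≤1+n y))
                          = lipschitz-close (∸ˡ-lipschitz a) (close-⊓ (∸ʳ-lipschitz (a + δ) y) (inj₁ refl))

    switches : δ ≡ 0 ⊎ (InLoops (γ a) × InLoops (γ (suc a)))
    switches with mod2≡0⊎mod2≡1 t
    ... | inj₁ δ≡0 = inj₁ δ≡0
    ... | inj₂ δ≡1 = inj₂ (γa , γ1+a δ≡1)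
      where
      γa : InLoops (γ a)
      γa rewrite ⊓-idem a | m≤n⇒m∸n≡0 (m≤m+n a δ) = ≤-refl , a≤c
      γ1+a : δ ≡ 1 → InLoops (γ (suc a))
      γ1+a e rewrite e | +-comm a 1 | n∸n≡0 a | m≥n⇒m⊓n≡n (n≤1+n a) = ≤-refl , a≤c

    k≤top : k ≤ (c + a) ∸ (a + δ)
    k≤top = m+n≤o⇒m≤o∸n k (≤-trans (≤-reflexive reassoc) (+-monoˡ-≤ a (≤-trans (∸+mod2≤ a t t<a) a≤c)))
      where
      reassoc : k + (a + δ) ≡ (k + δ) + a
      reassoc = trans (cong (k +_) (+-comm a δ)) (sym (+-assoc k δ a))

    reaches : fold (stepAbove a δ (c + a)) 0 (γ (c + a)) ≡ t
    reaches rewrite stepAbove-high a δ (c + a) (m<n+m a (≤-trans (s≤s z≤n) (≤-trans t<a a≤c)))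
                  | m≥n⇒m⊓n≡n (m≤n+m a c) | m≥n⇒m⊓n≡n k≤top | m∸[m∸n]≡n (<⇒≤ t<a)
                  = trans (fold-low δ 0 t (<⇒≤ t<a)) (lower-exact δ t (<⇒≤ t<a) (mod2-+-mod2 t))

    schedule : Schedule t
    schedule = record
      { γ           = γ
      ; ε           = stepAbove a δ
      ; γ-lipschitz = γ-lipschitz
      ; γ≤id        = λ y → ≤-trans (m∸n≤m (y ⊓ a) ((y ∸ (a + δ)) ⊓ k)) (m⊓n≤m y a)
      ; ε-switch    = stepAbove-switch γ a δ switches
      ; ε-low       = stepAbove-low a δ
      ; reaches     = reaches
      }

  -- γ climbs to c, waits there mod2 (k + a) steps to fix the parity, then climbs on to t.
  module AboveLoops (t : ℕ) (c<t : c < t) (t≤c+a : t ≤ c + a) where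
    k = t ∸ c
    δ = mod2 (k + a)

    γ : ℕ → ℕ
    γ y = (y ⊓ c) + ((y ∸ (c + δ)) ⊓ k)

    γ-lipschitz : Lipschitz γ
    γ-lipschitz y with suc y ≤? c
    ... | yes 1+y≤c rewrite m≤n⇒m⊓n≡m 1+y≤c | m≤n⇒m⊓n≡m (≤-trans (n≤1+n y) 1+y≤c)
                          | m≤n⇒m∸n≡0 (≤-trans 1+y≤c (m≤m+n c δ))
                          | m≤n⇒m∸n≡0 (≤-trans (≤-trans (n≤1+n y) 1+y≤c) (m≤m+n c δ))
                          = close-suc _
    ... | no  1+y≰c rewrite m≥n⇒m⊓n≡n (≤-pred (≰⇒> 1+y≰c))
                          | m≥n⇒m⊓n≡n (≤-trans (≤-pred (≰⇒> 1+y≰c)) (n≤1+n y))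
                          = lipschitz-close (+-lipschitz c) (close-⊓ (∸ʳ-lipschitz (c + δ) y) (inj₁ refl))

    switches : δ ≡ 0 ⊎ (InLoops (γ c) × InLoops (γ (suc c)))
    switches with mod2≡0⊎mod2≡1 (k + a)
    ... | inj₁ δ≡0 = inj₁ δ≡0
    ... | inj₂ δ≡1 = inj₂ (γc , γ1+c δ≡1)
      where
      γc : InLoops (γ c)
      γc rewrite ⊓-idem c | m≤n⇒m∸n≡0 (m≤m+n c δ) | +-identityʳ c = a≤c , ≤-refl
      γ1+c : δ ≡ 1 → InLoops (γ (suc c))
      γ1+c e rewrite e | +-comm c 1 | n∸n≡0 c | m≥n⇒m⊓n≡n (n≤1+n c) | +-identityʳ c = a≤c , ≤-refl

    k≤a : k ≤ a
    k≤a = ≤-trans (∸-monoˡ-≤ c t≤c+a) (≤-reflexive (m+n∸m≡n c a))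

    0<a : 0 < a
    0<a = +-cancelˡ-< c 0 a (≤-trans (s≤s (≤-reflexive (+-identityʳ c))) (≤-trans c<t t≤c+a))

    k≤a∸δ : k ≤ a ∸ δ
    k≤a∸δ with mod2≡0⊎mod2≡1 (k + a)
    ... | inj₁ δ≡0 rewrite δ≡0 = k≤a
    ... | inj₂ δ≡1 = m+n≤o⇒m≤o∸n k (≤-trans (≤-reflexive (trans (cong (k +_) δ≡1) (+-comm k 1))) k<a)
      where
      k<a : k < a
      k<a with k ≟ a
      ... | yes k≡a = ⊥-elim (0≢1+n (trans (sym (trans (cong (λ z → mod2 (z + a)) k≡a) (mod2-double a))) δ≡1))
      ... | no  k≢a = ≤∧≢⇒< k≤a k≢a

    γ≤id : ∀ y → γ y ≤ y
    γ≤id y with y ≤? c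
    ... | yes y≤c rewrite m≤n⇒m∸n≡0 (≤-trans y≤c (m≤m+n c δ)) | +-identityʳ (y ⊓ c) = m⊓n≤m y c
    ... | no  y≰c rewrite m≥n⇒m⊓n≡n (<⇒≤ (≰⇒> y≰c)) =
          ≤-trans (+-monoʳ-≤ c (≤-trans (m⊓n≤m _ k) (∸-monoʳ-≤ y (m≤m+n c δ))))
                  (≤-reflexive (m+[n∸m]≡n (<⇒≤ (≰⇒> y≰c))))

    mirror-even : mod2 ((a ∸ k) + δ) ≡ 0
    mirror-even = trans (cong (λ z → mod2 ((a ∸ k) + z)) δ≡mod2[a∸k]) (mod2-+-mod2 (a ∸ k))
      where
      δ≡mod2[a∸k] : δ ≡ mod2 (a ∸ k)
      δ≡mod2[a∸k] = begin
        mod2 (k + a)             ≡⟨ cong (λ z → mod2 (k + z)) (sym (m∸n+n≡m k≤a)) ⟩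
        mod2 (k + ((a ∸ k) + k)) ≡⟨ cong mod2 (trans (+-comm k ((a ∸ k) + k)) (+-assoc (a ∸ k) k k)) ⟩
        mod2 ((a ∸ k) + (k + k)) ≡⟨ mod2-+-double (a ∸ k) k ⟩
        mod2 (a ∸ k)             ∎
        where open ≡-Reasoning

    reaches : fold (stepAbove c δ (c + a)) 0 (γ (c + a)) ≡ t
    reaches rewrite stepAbove-high c δ (c + a) (m<m+n c 0<a) | m≥n⇒m⊓n≡n (m≤m+n c a)
                  | [m+n]∸[m+o]≡n∸o c a δ | m≥n⇒m⊓n≡n k≤a∸δ
                  | fold-high δ 0 (c + k) (m≤m+n c k) | [m+n]∸[m+o]≡n∸o c a k
                  | lower-exact δ (a ∸ k) (m∸n≤m a k) mirror-even | m∸[m∸n]≡n k≤a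
                  = m+[n∸m]≡n (<⇒≤ c<t)

    schedule : Schedule t
    schedule = record
      { γ           = γ
      ; ε           = stepAbove c δ
      ; γ-lipschitz = γ-lipschitz
      ; γ≤id        = γ≤id
      ; ε-switch    = stepAbove-switch γ c δ switches
      ; ε-low       = λ y y≤a → stepAbove-low c δ y (≤-trans y≤a a≤c)
      ; reaches     = reaches
      }

  schedule : ∀ t → t ≤ c + a → Schedule t
  schedule t t≤c+a with t <? a | c <? t
  ... | yes t<a | _       = BelowLoops.schedule t t<a
  ... | no  t≮a | yes c<t = AboveLoops.schedule t c<t t≤c+a
  ... | no  t≮a | no  c≮t = schedule-loops t (≮⇒≥ t≮a) (≮⇒≥ c≮t)

module PathPivot (a c : ℕ) (a≤c : a ≤ c) (Loop : ℕ → Set)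
                 (unlooped : ∀ v → v < a → ¬ Loop v)
                 (looped : ∀ v → a ≤ v → v ≤ c → Loop v) where
  open Folding a c a≤c

  Edge : ℕ → ℕ → Set
  Edge u v = (u ≡ suc v) ⊎ ((v ≡ suc u) ⊎ ((u ≡ v) × Loop u))

  Edge-sym : ∀ {u v} → Edge u v → Edge v u
  Edge-sym (inj₁ e)                = inj₂ (inj₁ e)
  Edge-sym (inj₂ (inj₁ e))         = inj₁ e
  Edge-sym (inj₂ (inj₂ (refl , l))) = inj₂ (inj₂ (refl , l))

  Edge⇒Close : ∀ {u v} → Edge u v → Close u v
  Edge⇒Close (inj₁ e)              = inj₂ (inj₂ e)
  Edge⇒Close (inj₂ (inj₁ e))       = inj₂ (inj₁ e)
  Edge⇒Close (inj₂ (inj₂ (e , _))) = inj₁ e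

  Edge-self⇒Loop : ∀ {u} → Edge u u → Loop u
  Edge-self⇒Loop (inj₁ u≡1+u)          = ⊥-elim (1+n≢n (sym u≡1+u))
  Edge-self⇒Loop (inj₂ (inj₁ u≡1+u))   = ⊥-elim (1+n≢n (sym u≡1+u))
  Edge-self⇒Loop (inj₂ (inj₂ (_ , l))) = l

  Close⇒Edge : ∀ {v w} → InLoops v → Close v w → Edge v w
  Close⇒Edge (a≤v , v≤c) (inj₁ refl)     = inj₂ (inj₂ (refl , looped _ a≤v v≤c))
  Close⇒Edge _           (inj₂ (inj₁ e)) = inj₂ (inj₁ e)
  Close⇒Edge _           (inj₂ (inj₂ e)) = inj₁ e

  CappedStep⇒Edge : ∀ {L L'} → CappedStep L L' → Edge L L'
  CappedStep⇒Edge (inj₁ e)                  = inj₂ (inj₁ e)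
  CappedStep⇒Edge (inj₂ (inj₁ e))           = inj₁ e
  CappedStep⇒Edge (inj₂ (inj₂ (refl , refl))) = inj₂ (inj₂ (refl , looped a ≤-refl a≤c))

  m∸n≡1+[m∸1+n] : ∀ m n → n < m → m ∸ n ≡ suc (m ∸ suc n)
  m∸n≡1+[m∸1+n] (suc m) zero    _         = refl
  m∸n≡1+[m∸1+n] (suc m) (suc n) (s≤s n<m) = m∸n≡1+[m∸1+n] m n n<m

  mirror-edge : ∀ {L L'} → CappedStep L L' → L ≤ a → L' ≤ a → Edge (c + (a ∸ L)) (c + (a ∸ L'))
  mirror-edge {L} (inj₁ refl) _ L'≤a rewrite m∸n≡1+[m∸1+n] a L L'≤a = inj₁ (+-suc c _)
  mirror-edge {_} {L'} (inj₂ (inj₁ refl)) L≤a _ rewrite m∸n≡1+[m∸1+n] a L' L≤a = inj₂ (inj₁ (+-suc c _))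
  mirror-edge (inj₂ (inj₂ (refl , refl))) _ _ rewrite n∸n≡0 a =
    inj₂ (inj₂ (refl , looped (c + 0) (≤-trans a≤c (m≤m+n c 0)) (≤-reflexive (+-identityʳ c))))

  data Region (g g' : ℕ) : Set where
    below : g ≤ a → g' ≤ a → Region g g'
    loops : InLoops g → InLoops g' → Region g g'
    above : c ≤ g → c ≤ g' → Region g g'

  close-above : ∀ {k g g'} → Close g g' → k < g → k ≤ g'
  close-above g~g' k<g = ≤-pred (≤-trans k<g (close⇒≤ g~g'))

  close-below : ∀ {k g g'} → Close g g' → g < k → g' ≤ k
  close-below g~g' g<k = ≤-trans (close⇒≤ (close-sym g~g')) g<k

  region-beyond-a : ∀ {g g'} → Close g g' → a ≤ g → a ≤ g' → Region g g'
  region-beyond-a {g} {g'} g~g' a≤g a≤g' with c ≤? g | c ≤? g'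
  ... | yes c≤g | yes c≤g' = above c≤g c≤g'
  ... | no  c≰g | _        = loops (a≤g , <⇒≤ (≰⇒> c≰g)) (a≤g' , close-below g~g' (≰⇒> c≰g))
  ... | _       | no c≰g'  = loops (a≤g , close-below (close-sym g~g') (≰⇒> c≰g')) (a≤g' , <⇒≤ (≰⇒> c≰g'))

  region : ∀ {g g'} → Close g g' → Region g g'
  region {g} {g'} g~g' with g ≤? a | g' ≤? a
  ... | yes g≤a | yes g'≤a = below g≤a g'≤a
  ... | no  g≰a | _        = region-beyond-a g~g' (<⇒≤ (≰⇒> g≰a)) (close-above g~g' (≰⇒> g≰a))
  ... | _       | no g'≰a  = region-beyond-a g~g' (close-above (close-sym g~g') (≰⇒> g'≰a)) (<⇒≤ (≰⇒> g'≰a))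

  fold-edge : ∀ e x {g g'} → Close g g' → Edge (fold e x g) (fold e (suc x) g')
  fold-edge e x {g} {g'} g~g' with region g~g'
  ... | below g≤a g'≤a rewrite fold-low e x g g≤a | fold-low e (suc x) g' g'≤a =
        CappedStep⇒Edge (lower-step e x g~g')
  ... | loops (a≤g , g≤c) (a≤g' , g'≤c) rewrite fold-mid e x g a≤g g≤c | fold-mid e (suc x) g' a≤g' g'≤c =
        Close⇒Edge (a≤g , g≤c) g~g'
  ... | above c≤g c≤g' rewrite fold-high e x g c≤g | fold-high e (suc x) g' c≤g' =
        mirror-edge (lower-step e x (lipschitz-close (∸ˡ-lipschitz (c + a)) g~g'))
                    (lower≤a e x ((c + a) ∸ g)) (lower≤a e (suc x) ((c + a) ∸ g'))

  ⊔-absorbs : ∀ {x w k} → w ≤ k → k < x ⊔ w → x ⊔ w ≡ x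
  ⊔-absorbs {x} {w} w≤k k<x⊔w with ⊔-sel x w
  ... | inj₁ x⊔w≡x = x⊔w≡x
  ... | inj₂ x⊔w≡w = ⊥-elim (<⇒≱ k<x⊔w (≤-trans (≤-reflexive x⊔w≡w) w≤k))

  -- If the two maxima coincide, they either lie in the looped block or equal x = x', whose edge is then a loop.
  ⊔-edge : ∀ {x x' w w'} → a ≤ x → Edge x x' → w ≤ c → w' ≤ c → Close w w' → Edge (x ⊔ w) (x' ⊔ w')
  ⊔-edge {x} {x'} {w} {w'} a≤x x~x' w≤c w'≤c w~w' with close-⊔ (Edge⇒Close x~x') w~w'
  ... | inj₂ (inj₁ e) = inj₂ (inj₁ e)
  ... | inj₂ (inj₂ e) = inj₁ e
  ... | inj₁ e with x ⊔ w ≤? c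
  ...   | yes x⊔w≤c = inj₂ (inj₂ (e , looped _ (≤-trans a≤x (m≤m⊔n x w)) x⊔w≤c))
  ...   | no  x⊔w≰c = inj₂ (inj₂ (e , subst Loop (sym x⊔w≡x) (Edge-self⇒Loop (subst (Edge x) (sym x≡x') x~x'))))
    where
    x⊔w≡x : x ⊔ w ≡ x
    x⊔w≡x = ⊔-absorbs w≤c (≰⇒> x⊔w≰c)
    x≡x' : x ≡ x'
    x≡x' = trans (sym x⊔w≡x) (trans e (⊔-absorbs w'≤c (≤-trans (≰⇒> x⊔w≰c) (≤-reflexive e))))

  module ScheduledPivot {t} (S : Schedule t) where
    open Schedule S

    ψ : ℕ → ℕ → ℕ
    ψ x y = x ⊔ fold (ε y) x (γ y)

    ψ-left : ∀ {x} y → x ≤ a → ψ x y ≡ fold (ε y) x (γ y)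
    ψ-left {x} y x≤a = m≤n⇒m⊔n≡n (x≤fold (ε y) x (γ y) x≤a)

    ψ-right : ∀ {x} y → a ≤ x → ψ x y ≡ x ⊔ (a ⊔ (γ y ⊓ c))
    ψ-right {x} y a≤x = cong (x ⊔_) (fold-right (ε y) x (γ y) a≤x)

    fold-scheduled-edge : ∀ x {y y'} → Close y y' → Edge (fold (ε y) x (γ y)) (fold (ε y') (suc x) (γ y'))
    fold-scheduled-edge x {y} {y'} y~y' with ε-switch y~y'
    ... | inj₁ ε≡ε' rewrite ε≡ε' = fold-edge (ε y') x (lipschitz-close γ-lipschitz y~y')
    ... | inj₂ ((a≤g , g≤c) , (a≤g' , g'≤c))
          rewrite fold-mid (ε y) x (γ y) a≤g g≤c | fold-mid (ε y') (suc x) (γ y') a≤g' g'≤c =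
          Close⇒Edge (a≤g , g≤c) (lipschitz-close γ-lipschitz y~y')

    ψ-edge-suc : ∀ x {y y'} → suc x ≤ a → Close y y' → Edge (ψ x y) (ψ (suc x) y')
    ψ-edge-suc x {y} {y'} 1+x≤a y~y' rewrite ψ-left y (≤-trans (n≤1+n x) 1+x≤a) | ψ-left y' 1+x≤a =
      fold-scheduled-edge x y~y'

    ψ-edge-unlooped : ∀ {x x' y y'} → x < a → Edge x x' → Close y y' → Edge (ψ x y) (ψ x' y')
    ψ-edge-unlooped x<a (inj₁ refl)            y~y' = Edge-sym (ψ-edge-suc _ (<⇒≤ x<a) (close-sym y~y'))
    ψ-edge-unlooped x<a (inj₂ (inj₁ refl))     y~y' = ψ-edge-suc _ x<a y~y'
    ψ-edge-unlooped x<a (inj₂ (inj₂ (_ , l))) _    = ⊥-elim (unlooped _ x<a l)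

    ψ-edge : ∀ {x x' y y'} → Edge x x' → Close y y' → Edge (ψ x y) (ψ x' y')
    ψ-edge {x} {x'} {y} {y'} x~x' y~y' with a ≤? x | a ≤? x'
    ... | yes a≤x | yes a≤x' rewrite ψ-right y a≤x | ψ-right y' a≤x' =
          ⊔-edge a≤x x~x' (⊔-lub a≤c (m⊓n≤n _ c)) (⊔-lub a≤c (m⊓n≤n _ c))
                 (close-⊔ (inj₁ refl) (close-⊓ (lipschitz-close γ-lipschitz y~y') (inj₁ refl)))
    ... | no a≰x | _        = ψ-edge-unlooped (≰⇒> a≰x) x~x' y~y'
    ... | _      | no a≰x'  = Edge-sym (ψ-edge-unlooped (≰⇒> a≰x') (Edge-sym x~x') (close-sym y~y'))

    ψ-idem : ∀ x → ψ x x ≡ x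
    ψ-idem x with a ≤? x
    ... | yes a≤x = m≥n⇒m⊔n≡m (fold≤ (ε x) x (γ x) (γ≤id x) (inj₁ a≤x))
    ... | no  a≰x = m≥n⇒m⊔n≡m (fold≤ (ε x) x (γ x) (γ≤id x) (inj₂ (ε-low x (<⇒≤ (≰⇒> a≰x)))))

    ψ-zero : ∀ x → ψ x 0 ≡ x
    ψ-zero x = m≥n⇒m⊔n≡m (fold≤ (ε 0) x (γ 0) (≤-trans (γ≤id 0) z≤n) (inj₂ (ε-low 0 z≤n)))

    ψ-reaches : ψ 0 (c + a) ≡ t
    ψ-reaches = reaches

    ψ≤c+a : ∀ {x} y → x ≤ c + a → ψ x y ≤ c + a
    ψ≤c+a {x} y x≤c+a = ⊔-lub x≤c+a (fold≤c+a (ε y) x (γ y))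

lookup-replicate-++ : ∀ {A : Set} n (x : A) ys (i : Fin (length (replicate n x ++ ys))) →
                      toℕ i < n → lookup (replicate n x ++ ys) i ≡ x
lookup-replicate-++ (suc n) x ys zero    _         = refl
lookup-replicate-++ (suc n) x ys (suc i) (s≤s i<n) = lookup-replicate-++ n x ys i i<n

lookup-replicate-++-replicate : ∀ {A : Set} n m (x y : A) zs (i : Fin (length (replicate n x ++ (replicate m y ++ zs)))) →
                                n ≤ toℕ i → toℕ i < n + m → lookup (replicate n x ++ (replicate m y ++ zs)) i ≡ y
lookup-replicate-++-replicate zero    m x y zs i       _         i<m     = lookup-replicate-++ m y zs i i<m
lookup-replicate-++-replicate (suc n) m x y zs (suc i) (s≤s n≤i) (s≤s i<n+m) =
  lookup-replicate-++-replicate n m x y zs i n≤i i<n+m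

module Word (a b' : ℕ) (α : Vec Bool a) where
  β = βword a (suc b') α
  c = a + b'

  a≤c : a ≤ c
  a≤c = m≤m+n a b'

  length-β : length β ≡ suc (c + a)
  length-β = begin
    length (replicate a false ++ (replicate (suc b') true ++ toList α))
      ≡⟨ length-++ (replicate a false) ⟩
    length (replicate a false) + length (replicate (suc b') true ++ toList α)
      ≡⟨ cong₂ _+_ (length-replicate a) (length-++ (replicate (suc b') true)) ⟩
    a + (length (replicate (suc b') true) + length (toList α))
      ≡⟨ cong (λ n → a + n) (cong₂ _+_ (length-replicate (suc b')) (length-toList α)) ⟩
    a + suc (b' + a)
      ≡⟨ +-suc a (b' + a) ⟩
    suc (a + (b' + a))
      ≡⟨ cong suc (sym (+-assoc a b' a)) ⟩
    suc (c + a) ∎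
    where open ≡-Reasoning

  vertex : ∀ {x} → x ≤ c + a → Vertex β
  vertex {x} x≤c+a = fromℕ< (subst (x <_) (sym length-β) (s≤s x≤c+a))

  toℕ≤c+a : ∀ (v : Vertex β) → toℕ v ≤ c + a
  toℕ≤c+a v = ≤-pred (subst (toℕ v <_) length-β (toℕ<n v))

  Loop : ℕ → Set
  Loop j = Σ (Vertex β) λ i → (toℕ i ≡ j) × (lookup β i ≡ true)

  unlooped : ∀ j → j < a → ¬ Loop j
  unlooped j j<a (i , refl , loop) with trans (sym loop) (lookup-replicate-++ a false _ i j<a)
  ... | ()

  looped : ∀ j → a ≤ j → j ≤ c → Loop j
  looped j a≤j j≤c = i , toℕ-i , lookup-replicate-++-replicate a (suc b') false true (toList α) i
    (subst (a ≤_) (sym toℕ-i) a≤j) (subst (_< a + suc b') (sym toℕ-i) (≤-trans (s≤s j≤c) (≤-reflexive (sym (+-suc a b')))))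
    where
    i : Vertex β
    i = vertex (≤-trans j≤c (m≤m+n c a))
    toℕ-i : toℕ i ≡ j
    toℕ-i = toℕ-fromℕ< _

  open PathPivot a c a≤c Loop unlooped looped
  open Folding a c a≤c using (schedule)

  Adj⇒Edge : ∀ {u v} → Adj β u v → Edge (toℕ u) (toℕ v)
  Adj⇒Edge (inj₁ e)                  = inj₁ e
  Adj⇒Edge (inj₂ (inj₁ e))           = inj₂ (inj₁ e)
  Adj⇒Edge {u} (inj₂ (inj₂ (refl , l))) = inj₂ (inj₂ (refl , (u , refl , l)))

  Edge⇒Adj : ∀ {u v} → Edge (toℕ u) (toℕ v) → Adj β u v
  Edge⇒Adj (inj₁ e)                          = inj₁ e
  Edge⇒Adj (inj₂ (inj₁ e))                   = inj₂ (inj₁ e)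
  Edge⇒Adj (inj₂ (inj₂ (e , (w , w≡u , l)))) =
    inj₂ (inj₂ (toℕ-injective e , subst (λ z → lookup β z ≡ true) (toℕ-injective w≡u) l))

  bot top : Vertex β
  bot = vertex z≤n
  top = vertex ≤-refl

  pivot : ∀ t → Pivot β bot top t
  pivot t = record
    { op      = op
    ; op-adj  = λ u~u' v~v' → Edge⇒Adj (subst₂ Edge (sym toℕ-op) (sym toℕ-op)
                                  (ψ-edge (Adj⇒Edge u~u') (Edge⇒Close (Adj⇒Edge v~v'))))
    ; op-idem = λ u → toℕ-injective (trans toℕ-op (ψ-idem (toℕ u)))
    ; op-bot  = λ u → toℕ-injective (trans toℕ-op (trans (cong (ψ (toℕ u)) (toℕ-fromℕ< _)) (ψ-zero (toℕ u))))
    ; op-top  = toℕ-injective (trans toℕ-op (trans (cong₂ ψ (toℕ-fromℕ< _) (toℕ-fromℕ< _)) ψ-reaches))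
    }
    where
    open ScheduledPivot (schedule (toℕ t) (toℕ≤c+a t))
    op : Vertex β → Vertex β → Vertex β
    op u v = vertex (ψ≤c+a (toℕ v) (toℕ≤c+a u))
    toℕ-op : ∀ {u v} → toℕ (op u v) ≡ ψ (toℕ u) (toℕ v)
    toℕ-op = toℕ-fromℕ< _

  generates : ∀ m → Generates β m (IsGenerator β m)
  generates = Generation.generates pivot (toℕ-fromℕ< _) (trans (toℕ-fromℕ< _) (sym (cong pred length-β)))

lemma3 : (a b : ℕ) → 1 ≤ b → (α : Vec Bool a) → (m : ℕ) → 1 ≤ m →
    Generates (βword a b α) m (IsGenerator (βword a b α) m)
lemma3 a (suc b') _ α m _ = Word.generates a b' α m
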